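{- Let $G$ be a finite simple graph with exactly $k$ isolated vertices. Then $B(G)\leq b(G)\leq Z(L(G))+k$.
   Context: For a finite simple graph $H$: colour each vertex black or white. A black vertex $v$ may force a white neighbour $w$ to become black if $w$ is the only white neighbour of $v$. A set $S\subseteq V(H)$ is a zero-forcing set if, colouring exactly the vertices of $S$ black and repeatedly applying this rule, all vertices eventually become black. The zero-forcing number $Z(H)$ is the minimum size of a zero-forcing set (and $Z$ of the graph with no vertices is $0$). Brushing: initially every vertex and every edge of $G$ is dirty. An initial configuration places a nonnegative integer number of brushes at each vertex. At each step a single remaining vertex $v$ fires; $v$ may fire only if the number of brushes currently at $v$ is at least the number of dirty edges currently incident with $v$. When $v$ fires, $v$ becomes clean, and each dirty edge incident with $v$ is traversed by at least one brush (distinct brushes for distinct edges), which cleans that edge and moves those brushes to its other endpoint; excess brushes may remain at $v$ but play no further role; $v$ and its incident edges are then removed. The process ends when no vertex can fire. A configuration cleans $G$ if some such process cleans all vertices and edges. $B(G)$ is the minimum total number of brushes in a configuration that cleans $G$ when several brushes are allowed to traverse the same edge simultaneously; $b(G)$ is the same minimum when, each time a vertex fires, exactly one brush is moved along each incident dirty edge (the remaining brushes staying at $v$). $L(G)$ denotes the line graph of $G$: its vertices are the edges of $G$, two being adjacent iff they share an endpoint in $G$. -}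

module Defs where

open import Data.Nat using (ℕ; zero; suc; _+_; _≤_)
open import Data.Bool using (Bool; true; false; _∧_; _∨_; not; if_then_else_)
open import Data.Fin using (Fin; _<_) renaming (_≟_ to _≟ᶠ_)
open import Data.Fin.Properties using (_<?_)
open import Data.List using (List; []; _∷_; length; lookup; concatMap; allFin; tabulate)
open import Data.Nat.ListAction using (sum)
open import Data.Bool.ListAction using (any)
open import Data.Product using (Σ; _×_; _,_; proj₁; proj₂)
open import Relation.Nullary using (¬_; does)
open import Relation.Binary.PropositionalEquality using (_≡_)

record Graph : Set where
  field
    n   : ℕ
    adj : Fin n → Fin n → Bool
open Graph public

IsSimple : Graph → Set
IsSimple G = (∀ i j → adj G i j ≡ adj G j i) × (∀ i → adj G i i ≡ false)

sumF : {n : ℕ} → (Fin n → ℕ) → ℕ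
sumF {n} f = sum (tabulate {n = n} f)

VSet : ℕ → Set
VSet n = Fin n → Bool

count : {n : ℕ} → VSet n → ℕ
count S = sumF (λ v → if S v then 1 else 0)

anyF : {n : ℕ} → (Fin n → Bool) → Bool
anyF {n} f = any f (allFin n)

eqF : {n : ℕ} → Fin n → Fin n → Bool
eqF i j = does (i ≟ᶠ j)

setAt : {n : ℕ} → VSet n → Fin n → Bool → VSet n
setAt S w b u = if eqF u w then b else S u

isolated : (G : Graph) → Fin (n G) → Bool
isolated G v = not (anyF (λ u → adj G v u))

numIsolated : Graph → ℕ
numIsolated G = count (isolated G)

-- The edges of G are listed as pairs (i , j) with i < j and
-- adj i j = true (each edge of a simple graph exactly once); the line graph
-- has vertex set Fin (number of edges), two distinct edges adjacent iff
-- they share an endpoint.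

edgesOf : (G : Graph) → List (Fin (n G) × Fin (n G))
edgesOf G = concatMap (λ i → concatMap (λ j →
              if does (i <? j) ∧ adj G i j then (i , j) ∷ [] else [])
              (allFin (n G))) (allFin (n G))

shareEnd : {m : ℕ} → Fin m × Fin m → Fin m × Fin m → Bool
shareEnd (a , b) (c , d) = eqF a c ∨ eqF a d ∨ eqF b c ∨ eqF b d

L : Graph → Graph
L G = record
  { n   = length (edgesOf G)
  ; adj = λ e f → not (eqF e f) ∧
                  shareEnd (lookup (edgesOf G) e) (lookup (edgesOf G) f)
  }

data ZF (H : Graph) : VSet (n H) → Set where
  allBlack : {S : VSet (n H)} → (∀ v → S v ≡ true) → ZF H S
  force    : {S : VSet (n H)} (v w : Fin (n H)) →
             S v ≡ true → S w ≡ false → adj H v w ≡ true →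
             (∀ u → adj H v u ≡ true → ¬ (u ≡ w) → S u ≡ true) →
             ZF H (setAt S w true) → ZF H S

IsZeroForcingSet : (H : Graph) → VSet (n H) → Set
IsZeroForcingSet H S = ZF H S

IsZ : Graph → ℕ → Set
IsZ H z = Σ (VSet (n H)) (λ S → IsZeroForcingSet H S × count S ≡ z)
        × (∀ S → IsZeroForcingSet H S → z ≤ count S)

-- Brushing. State: R = remaining (unfired) vertices, β = brushes at each
-- vertex. An edge is dirty iff both endpoints remain.

dirtyNb : (G : Graph) → VSet (n G) → Fin (n G) → Fin (n G) → Bool
dirtyNb G R v u = R u ∧ adj G v u ∧ not (eqF u v)

dirtyDeg : (G : Graph) → VSet (n G) → Fin (n G) → ℕ
dirtyDeg G R v = count (dirtyNb G R v)

-- Model B: several brushes may traverse the same edge; t u brushes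
-- go along the dirty edge vu (t u ≥ 1, distinct brushes, total ≤ β v).
data CleansB (G : Graph) : VSet (n G) → (Fin (n G) → ℕ) → Set where
  done : {R : VSet (n G)} {β : Fin (n G) → ℕ} →
         (∀ u → R u ≡ false) → CleansB G R β
  fire : {R : VSet (n G)} {β : Fin (n G) → ℕ} (v : Fin (n G)) →
         R v ≡ true → dirtyDeg G R v ≤ β v →
         (t : Fin (n G) → ℕ) →
         (∀ u → dirtyNb G R v u ≡ true → 1 ≤ t u) →
         sumF (λ u → if dirtyNb G R v u then t u else 0) ≤ β v →
         CleansB G (setAt R v false)
                   (λ u → if dirtyNb G R v u then β u + t u else β u) →
         CleansB G R β

-- Model b: exactly one brush moves along each dirty incident edge.
data Cleansb (G : Graph) : VSet (n G) → (Fin (n G) → ℕ) → Set where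
  done : {R : VSet (n G)} {β : Fin (n G) → ℕ} →
         (∀ u → R u ≡ false) → Cleansb G R β
  fire : {R : VSet (n G)} {β : Fin (n G) → ℕ} (v : Fin (n G)) →
         R v ≡ true → dirtyDeg G R v ≤ β v →
         Cleansb G (setAt R v false)
                   (λ u → if dirtyNb G R v u then suc (β u) else β u) →
         Cleansb G R β

allV : {m : ℕ} → VSet m
allV _ = true

CleansConfB : (G : Graph) → (Fin (n G) → ℕ) → Set
CleansConfB G c = CleansB G allV c

CleansConfb : (G : Graph) → (Fin (n G) → ℕ) → Set
CleansConfb G c = Cleansb G allV c

IsBigB : Graph → ℕ → Set
IsBigB G m = Σ (Fin (n G) → ℕ) (λ c → CleansConfB G c × sumF c ≡ m)
           × (∀ c → CleansConfB G c → m ≤ sumF c)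

IsSmallb : Graph → ℕ → Set
IsSmallb G m = Σ (Fin (n G) → ℕ) (λ c → CleansConfb G c × sumF c ≡ m)
             × (∀ c → CleansConfb G c → m ≤ sumF c)

module Submission where

-- Fire the vertices of G alongside a zero-forcing process on L(G), calling a vertex saturated
-- when all its edges are black. Every fired vertex stays saturated, every saturated vertex is
-- fired as soon as possible, and a vertex about to fire receives on the spot the brushes it
-- lacks. The number of black edges with both ends unfired pays for these extra brushes: firing a
-- saturated vertex v removes dirtyDeg v of them and needs at most dirtyDeg v new brushes. A
-- forcing E → F, with E = ax and F = aw, adds one black edge and saturates a; as x is then
-- saturated too, x has already fired and sent a brush to a, so firing a needs at most
-- dirtyDeg a - 1 new brushes. Starting from a zero-forcing set S with no brushes, at most |S|
-- brushes are ever added.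

open import Algebra.Properties.CommutativeSemigroup as CSemigroup using ()
open import Axiom.UniquenessOfIdentityProofs using (module Decidable⇒UIP)
open import Data.Bool using (Bool; true; false; _∧_; _∨_; not; if_then_else_)
open import Data.Bool.Properties using (∨-zeroʳ; ∧-zeroʳ; ∧-conicalˡ; ∧-conicalʳ)
  renaming (_≟_ to _≟ᵇ_)
open import Data.Empty using (⊥-elim)
open import Data.Fin using (Fin; zero; suc) renaming (_<_ to _<ᶠ_)
open import Data.Fin.Properties using (any?; all?; <-cmp; <-irrefl; _<?_)
  renaming (_≟_ to _≟ᶠ_; suc-injective to sucᶠ-injective)
open import Data.List using (List; []; _∷_; length; lookup; concatMap; allFin)
open import Data.List.Membership.Propositional using (_∈_; lose)
open import Data.List.Membership.Propositional.Properties
  using (∈-concatMap⁺; ∈-concatMap⁻; ∈-lookup; ∈-allFin)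
open import Data.List.Relation.Unary.Any using (here; satisfied; index)
open import Data.List.Relation.Unary.Any.Properties using (lookup-index)
open import Data.Nat using (ℕ; zero; suc; _+_; _∸_; _≤_; z≤n; s≤s; s≤s⁻¹)
open import Data.Nat.Properties
  using (≤-refl; ≤-trans; +-comm; +-identityʳ; m≤m+n; m≤n+m; +-monoˡ-≤; +-monoʳ-≤; n≤1+n;
         m≤n+m∸n; m∸n≤m; +-suc;
         +-commutativeSemigroup; module ≤-Reasoning)
open import Data.Product using (Σ; _×_; _,_; proj₁; proj₂)
import Data.Product as Product
open import Data.Sum using (_⊎_; inj₁; inj₂)
import Data.Sum as Sum
open import Function using (_∘_)
open import Relation.Binary.PropositionalEquality
open import Relation.Binary.Definitions using (tri<; tri≈; tri>)
open import Relation.Nullary using (Dec; yes; no; does)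
open import Relation.Nullary.Decidable using (_×-dec_; _⊎-dec_; _→-dec_; dec-true; dec-false)

open import Defs

open CSemigroup +-commutativeSemigroup using (interchange; x∙yz≈y∙xz)

ind : Bool → ℕ
ind b = if b then 1 else 0

does-true : ∀ {P : Set} (P? : Dec P) → does P? ≡ true → P
does-true (yes p) _ = p

eqF-≡ : ∀ {k} {u v : Fin k} → eqF u v ≡ true → u ≡ v
eqF-≡ {u = u} {v} = does-true (u ≟ᶠ v)

eqF-≡⁺ : ∀ {k} {u v : Fin k} → u ≡ v → eqF u v ≡ true
eqF-≡⁺ {u = u} {v} = dec-true (u ≟ᶠ v)

eqF-≢ : ∀ {k} {u v : Fin k} → u ≢ v → eqF u v ≡ false
eqF-≢ {u = u} {v} = dec-false (u ≟ᶠ v)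

∨-introʳ : ∀ a {b} → b ≡ true → a ∨ b ≡ true
∨-introʳ a refl = ∨-zeroʳ a

setAt-≡ : ∀ {k} (R : VSet k) v b → setAt R v b v ≡ b
setAt-≡ R v b rewrite eqF-≡⁺ (refl {x = v}) = refl

setAt-≢ : ∀ {k} (R : VSet k) {v u} b → u ≢ v → setAt R v b u ≡ R u
setAt-≢ R b u≢v rewrite eqF-≢ u≢v = refl

setAt-false-⊆ : ∀ {k} (R : VSet k) v u → setAt R v false u ≡ true → R u ≡ true
setAt-false-⊆ R v u h with eqF u v
... | false = h

setAt-true-⊇ : ∀ {k} (R : VSet k) v u → R u ≡ true → setAt R v true u ≡ true
setAt-true-⊇ R v u Ru with eqF u v
... | true  = refl
... | false = Ru

setAt-false-≢ : ∀ {k} (R : VSet k) {v u} → setAt R v false u ≡ true → u ≢ v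
setAt-false-≢ R {v} R'u refl with trans (sym (setAt-≡ R v false)) R'u
... | ()

sumF-cong : ∀ {k} {f g : Fin k → ℕ} → (∀ u → f u ≡ g u) → sumF f ≡ sumF g
sumF-cong {zero}  f≗g = refl
sumF-cong {suc k} f≗g = cong₂ _+_ (f≗g zero) (sumF-cong (f≗g ∘ suc))

sumF-+ : ∀ {k} (f g : Fin k → ℕ) → sumF (λ u → f u + g u) ≡ sumF f + sumF g
sumF-+ {zero}  f g = refl
sumF-+ {suc k} f g = trans (cong (f zero + g zero +_) (sumF-+ (f ∘ suc) (g ∘ suc)))
                           (interchange (f zero) (g zero) _ _)

sumF-zero : ∀ k → sumF {k} (λ _ → 0) ≡ 0
sumF-zero zero    = refl
sumF-zero (suc k) = sumF-zero k

point : ∀ {k} → Fin k → ℕ → Fin k → ℕ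
point v x u = if eqF u v then x else 0

point-self : ∀ {k} (v : Fin k) x → point v x v ≡ x
point-self v x rewrite eqF-≡⁺ (refl {x = v}) = refl

sumF-point : ∀ {k} (v : Fin k) x → sumF (point v x) ≡ x
sumF-point {suc k} zero    x = trans (cong (x +_) (sumF-zero k)) (+-identityʳ x)
sumF-point {suc k} (suc v) x = sumF-point v x

count-setAt : ∀ {k} (R : VSet k) v b → ind (R v) + count (setAt R v b) ≡ ind b + count R
count-setAt R zero    b = x∙yz≈y∙xz (ind (R zero)) (ind b) _
count-setAt R (suc v) b = begin
  ind (R (suc v)) + (ind (R zero) + count (setAt (R ∘ suc) v b))
    ≡⟨ x∙yz≈y∙xz (ind (R (suc v))) (ind (R zero)) _ ⟩
  ind (R zero) + (ind (R (suc v)) + count (setAt (R ∘ suc) v b))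
    ≡⟨ cong (ind (R zero) +_) (count-setAt (R ∘ suc) v b) ⟩
  ind (R zero) + (ind b + count (R ∘ suc))
    ≡⟨ x∙yz≈y∙xz (ind (R zero)) (ind b) _ ⟩
  ind b + count R ∎
  where open ≡-Reasoning

count-remove : ∀ {k} (R : VSet k) {v} → R v ≡ true → suc (count (setAt R v false)) ≡ count R
count-remove R {v} Rv = subst (λ b → ind b + count (setAt R v false) ≡ count R) Rv
                              (count-setAt R v false)

count-pos : ∀ {k} (R : VSet k) {v} → R v ≡ true → 1 ≤ count R
count-pos R Rv = subst (1 ≤_) (count-remove R Rv) (s≤s z≤n)

count-setAt-true : ∀ {k} (R : VSet k) v → count (setAt R v true) ≤ suc (count R)
count-setAt-true R v = subst (count (setAt R v true) ≤_) (count-setAt R v true)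
                             (m≤n+m _ (ind (R v)))

count-split : ∀ {k} (A B : VSet k) →
  count (λ u → A u ∧ B u) + count (λ u → A u ∧ not (B u)) ≡ count A
count-split A B = trans (sym (sumF-+ (λ u → ind (A u ∧ B u)) (λ u → ind (A u ∧ not (B u)))))
                        (sumF-cong split)
  where
  split : ∀ u → ind (A u ∧ B u) + ind (A u ∧ not (B u)) ≡ ind (A u)
  split u with A u | B u
  ... | true  | true  = refl
  ... | true  | false = refl
  ... | false | _     = refl

record _↪_ {k l} (P : VSet k) (Q : VSet l) : Set where
  field
    to     : ∀ u → P u ≡ true → Fin l
    to-∈   : ∀ u p → Q (to u p) ≡ true
    to-inj : ∀ {u u'} p p' → to u p ≡ to u' p' → u ≡ u'
open _↪_

⊆⇒↪ : ∀ {k} {P Q : VSet k} → (∀ u → P u ≡ true → Q u ≡ true) → P ↪ Q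
⊆⇒↪ P⊆Q = record { to = λ u _ → u ; to-∈ = P⊆Q ; to-inj = λ _ _ eq → eq }

↪-avoid : ∀ {k l} {P : VSet k} {Q : VSet l} (ι : P ↪ Q) {q} →
          (∀ u p → to ι u p ≢ q) → P ↪ setAt Q q false
↪-avoid {Q = Q} ι avoid = record
  { to     = to ι
  ; to-∈   = λ u p → trans (setAt-≢ Q false (avoid u p)) (to-∈ ι u p)
  ; to-inj = to-inj ι
  }

↪-tail : ∀ {k l} {P : VSet (suc k)} {Q : VSet l} → P ↪ Q → (P ∘ suc) ↪ Q
↪-tail ι = record
  { to     = to ι ∘ suc
  ; to-∈   = to-∈ ι ∘ suc
  ; to-inj = λ p p' → sucᶠ-injective ∘ to-inj ι p p'
  }

count-mono-↪ : ∀ {k l} {P : VSet k} {Q : VSet l} → P ↪ Q → count P ≤ count Q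
count-mono-↪ {zero} ι = z≤n
count-mono-↪ {suc k} {P = P} {Q} ι with P zero in P0
... | false = count-mono-↪ (↪-tail ι)
... | true  = begin
  suc (count (P ∘ suc))                       ≤⟨ s≤s (count-mono-↪ (↪-avoid (↪-tail ι) avoid)) ⟩
  suc (count (setAt Q (to ι zero P0) false))  ≡⟨ count-remove Q (to-∈ ι zero P0) ⟩
  count Q                                     ∎
  where
  open ≤-Reasoning
  avoid : ∀ u p → to ι (suc u) p ≢ to ι zero P0
  avoid u p eq with to-inj ι p P0 eq
  ... | ()

count-mono-↪-missing : ∀ {k l} {P : VSet k} {Q : VSet l} (ι : P ↪ Q) {q} → Q q ≡ true →
                       (∀ u p → to ι u p ≢ q) → suc (count P) ≤ count Q
count-mono-↪-missing {P = P} {Q} ι Qq avoid =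
  subst (suc (count P) ≤_) (count-remove Q Qq) (s≤s (count-mono-↪ (↪-avoid ι avoid)))

m+1+n≤1+p⇒m+[n∸o]≤p : ∀ m n o {p} → m + suc n ≤ suc p → m + (n ∸ o) ≤ p
m+1+n≤1+p⇒m+[n∸o]≤p m n o {p} h =
  ≤-trans (+-monoʳ-≤ m (m∸n≤m n o)) (s≤s⁻¹ (subst (_≤ suc p) (+-suc m n) h))

m+n≤1+p⇒m+[n∸o]≤p : ∀ m n o {p} → m + n ≤ suc p → 1 ≤ n → 1 ≤ o → m + (n ∸ o) ≤ p
m+n≤1+p⇒m+[n∸o]≤p m (suc n) (suc o) h _ _ = m+1+n≤1+p⇒m+[n∸o]≤p m n o h

Cleansb-mono : ∀ {G R β β'} → Cleansb G R β → (∀ u → β u ≤ β' u) → Cleansb G R β'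
Cleansb-mono (done allFired) _ = done allFired
Cleansb-mono {G} {R} {β} {β'} (fire v Rv enough rest) β≤β' =
  fire v Rv (≤-trans enough (β≤β' v)) (Cleansb-mono rest moved≤)
  where
  moved≤ : ∀ u → (if dirtyNb G R v u then suc (β u) else β u)
             ≤ (if dirtyNb G R v u then suc (β' u) else β' u)
  moved≤ u with dirtyNb G R v u
  ... | true  = s≤s (β≤β' u)
  ... | false = β≤β' u

-- Brush vectors are compared pointwise because Cleansb moves to suc (β u) and CleansB to β u + 1.
Cleansb⇒CleansB : ∀ {G R β β'} → Cleansb G R β → (∀ u → β u ≡ β' u) → CleansB G R β'
Cleansb⇒CleansB (done allFired) _ = done allFired
Cleansb⇒CleansB {G} {R} {β} {β'} (fire v Rv enough rest) β≗β' =
  fire v Rv enough' (λ _ → 1) (λ _ _ → ≤-refl) enough' (Cleansb⇒CleansB rest moved≗)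
  where
  enough' : dirtyDeg G R v ≤ β' v
  enough' = subst (dirtyDeg G R v ≤_) (β≗β' v) enough
  moved≗ : ∀ u → (if dirtyNb G R v u then suc (β u) else β u)
               ≡ (if dirtyNb G R v u then β' u + 1 else β' u)
  moved≗ u with dirtyNb G R v u
  ... | true  = trans (cong suc (β≗β' u)) (+-comm 1 (β' u))
  ... | false = β≗β' u

module Edges (G : Graph) where

  V : Set
  V = Fin (n G)

  Edge : Set
  Edge = Fin (length (edgesOf G))

  ends : Edge → V × V
  ends = lookup (edgesOf G)

  private
    candidate : V → V → List (V × V)
    candidate i j = if does (i <? j) ∧ adj G i j then (i , j) ∷ [] else []

    ∈-candidate⁻ : ∀ {p i j} → p ∈ candidate i j → p ≡ (i , j) × i <ᶠ j × adj G i j ≡ true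
    ∈-candidate⁻ {i = i} {j} p∈ with does (i <? j) in i<j | adj G i j
    ∈-candidate⁻ {i = i} {j} (here refl) | true | true = refl , does-true (i <? j) i<j , refl

    ∈-candidate⁺ : ∀ {i j} → i <ᶠ j → adj G i j ≡ true → (i , j) ∈ candidate i j
    ∈-candidate⁺ {i} {j} i<j ij rewrite dec-true (i <? j) i<j | ij = here refl

  ∈-edgesOf⁻ : ∀ {p} → p ∈ edgesOf G → proj₁ p <ᶠ proj₂ p × adj G (proj₁ p) (proj₂ p) ≡ true
  ∈-edgesOf⁻ p∈
    with satisfied (∈-concatMap⁻ (λ i → concatMap (candidate i) (allFin (n G)))
                                 {xs = allFin (n G)} p∈)
  ... | i , p∈ᵢ with satisfied (∈-concatMap⁻ (candidate i) {xs = allFin (n G)} p∈ᵢ)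
  ... | j , p∈ᵢⱼ with ∈-candidate⁻ p∈ᵢⱼ
  ... | refl , i<j , ij = i<j , ij

  ∈-edgesOf⁺ : ∀ {i j} → i <ᶠ j → adj G i j ≡ true → (i , j) ∈ edgesOf G
  ∈-edgesOf⁺ {i} {j} i<j ij =
    ∈-concatMap⁺ (λ i → concatMap (candidate i) (allFin (n G)))
      (lose (∈-allFin i) (∈-concatMap⁺ (candidate i) (lose (∈-allFin j) (∈-candidate⁺ i<j ij))))

  ends-< : ∀ g → proj₁ (ends g) <ᶠ proj₂ (ends g)
  ends-< g = proj₁ (∈-edgesOf⁻ (∈-lookup g))

  ends-adj : ∀ g → adj G (proj₁ (ends g)) (proj₂ (ends g)) ≡ true
  ends-adj g = proj₂ (∈-edgesOf⁻ (∈-lookup g))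

  edge-of : ∀ {i j} → i <ᶠ j → adj G i j ≡ true → Σ Edge λ g → ends g ≡ (i , j)
  edge-of {i} {j} i<j ij = index ij∈ , sym (lookup-index ij∈)
    where
    ij∈ : (i , j) ∈ edgesOf G
    ij∈ = ∈-edgesOf⁺ i<j ij

  Incident : V → Edge → Set
  Incident v g = v ≡ proj₁ (ends g) ⊎ v ≡ proj₂ (ends g)

  Joins : Edge → V → V → Set
  Joins g a x = ends g ≡ (a , x) ⊎ ends g ≡ (x , a)

  joins-sym : ∀ {g a x} → Joins g a x → Joins g x a
  joins-sym = Sum.swap

  joins-incident : ∀ {g a x} → Joins g a x → Incident a g
  joins-incident (inj₁ g≡ax) = inj₁ (sym (cong proj₁ g≡ax))
  joins-incident (inj₂ g≡xa) = inj₂ (sym (cong proj₂ g≡xa))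

  incident-joins : ∀ {a g} → Incident a g → Σ V (Joins g a)
  incident-joins {g = g} (inj₁ refl) = proj₂ (ends g) , inj₁ refl
  incident-joins {g = g} (inj₂ refl) = proj₁ (ends g) , inj₂ refl

  joins-incident⁻ : ∀ {g a x y} → Joins g a x → Incident y g → y ≡ a ⊎ y ≡ x
  joins-incident⁻ (inj₁ g≡ax) (inj₁ y≡) = inj₁ (trans y≡ (cong proj₁ g≡ax))
  joins-incident⁻ (inj₁ g≡ax) (inj₂ y≡) = inj₂ (trans y≡ (cong proj₂ g≡ax))
  joins-incident⁻ (inj₂ g≡xa) (inj₁ y≡) = inj₂ (trans y≡ (cong proj₁ g≡xa))
  joins-incident⁻ (inj₂ g≡xa) (inj₂ y≡) = inj₁ (trans y≡ (cong proj₂ g≡xa))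

  joins-≢ : ∀ {g a x} → Joins g a x → a ≢ x
  joins-≢ {g} (inj₁ g≡ax) refl = <-irrefl refl (subst (λ p → proj₁ p <ᶠ proj₂ p) g≡ax (ends-< g))
  joins-≢ {g} (inj₂ g≡xa) refl = <-irrefl refl (subst (λ p → proj₁ p <ᶠ proj₂ p) g≡xa (ends-< g))

  joins-unique : ∀ {g a x y} → Joins g a x → Joins g a y → x ≡ y
  joins-unique g-ax g-ay with joins-incident⁻ g-ax (joins-incident (joins-sym g-ay))
  ... | inj₁ y≡a = ⊥-elim (joins-≢ g-ay (sym y≡a))
  ... | inj₂ y≡x = sym y≡x

  shareEnd⇒common : ∀ e f → shareEnd (ends e) (ends f) ≡ true →
                    Σ V λ a → Incident a e × Incident a f
  shareEnd⇒common e f share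
    with eqF (proj₁ (ends e)) (proj₁ (ends f)) in h₁ | eqF (proj₁ (ends e)) (proj₂ (ends f)) in h₂
       | eqF (proj₂ (ends e)) (proj₁ (ends f)) in h₃ | eqF (proj₂ (ends e)) (proj₂ (ends f)) in h₄
  ... | true  | _     | _     | _    = _ , inj₁ refl , inj₁ (eqF-≡ h₁)
  ... | false | true  | _     | _    = _ , inj₁ refl , inj₂ (eqF-≡ h₂)
  ... | false | false | true  | _    = _ , inj₂ refl , inj₁ (eqF-≡ h₃)
  ... | false | false | false | true = _ , inj₂ refl , inj₂ (eqF-≡ h₄)

  common⇒shareEnd : ∀ {a e f} → Incident a e → Incident a f → shareEnd (ends e) (ends f) ≡ true
  common⇒shareEnd {e = e} {f} = common (ends e) (ends f)
    where
    common : ∀ {a} (p q : V × V) → a ≡ proj₁ p ⊎ a ≡ proj₂ p → a ≡ proj₁ q ⊎ a ≡ proj₂ q →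
             shareEnd p q ≡ true
    common {a} _ _ (inj₁ refl) (inj₁ refl) rewrite eqF-≡⁺ (refl {x = a}) = refl
    common {a} _ (q₁ , _) (inj₁ refl) (inj₂ refl) rewrite eqF-≡⁺ (refl {x = a}) =
      ∨-zeroʳ (eqF a q₁)
    common {a} (p₁ , _) (_ , q₂) (inj₂ refl) (inj₁ refl) rewrite eqF-≡⁺ (refl {x = a}) =
      ∨-introʳ (eqF p₁ a) (∨-zeroʳ (eqF p₁ q₂))
    common {a} (p₁ , _) (q₁ , _) (inj₂ refl) (inj₂ refl) rewrite eqF-≡⁺ (refl {x = a}) =
      ∨-introʳ (eqF p₁ q₁) (∨-introʳ (eqF p₁ a) (∨-zeroʳ (eqF a q₁)))

module BrushingAlongForcing (G : Graph) (adj-sym : ∀ i j → adj G i j ≡ adj G j i) where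

  open Edges G

  joins-adj : ∀ {g a x} → Joins g a x → adj G a x ≡ true
  joins-adj {g} (inj₁ g≡ax) = subst (λ p → adj G (proj₁ p) (proj₂ p) ≡ true) g≡ax (ends-adj g)
  joins-adj {g} {a} {x} (inj₂ g≡xa) =
    trans (adj-sym a x) (subst (λ p → adj G (proj₁ p) (proj₂ p) ≡ true) g≡xa (ends-adj g))

  edge-between : ∀ {v u} → adj G v u ≡ true → u ≢ v → Σ Edge λ g → Joins g v u
  edge-between {v} {u} vu u≢v with <-cmp v u
  ... | tri< v<u _ _ = Product.map₂ inj₁ (edge-of v<u vu)
  ... | tri≈ _ v≡u _ = ⊥-elim (u≢v (sym v≡u))
  ... | tri> _ _ u<v = Product.map₂ inj₂ (edge-of u<v (trans (adj-sym u v) vu))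

  dirtyNb-remaining : ∀ {R v u} → dirtyNb G R v u ≡ true → R u ≡ true
  dirtyNb-remaining {R} {v} {u} = ∧-conicalˡ (R u) _

  dirtyNb-adj : ∀ {R v u} → dirtyNb G R v u ≡ true → adj G v u ≡ true
  dirtyNb-adj {R} {v} {u} = ∧-conicalˡ (adj G v u) _ ∘ ∧-conicalʳ (R u) _

  dirtyNb-≢ : ∀ {R v u} → dirtyNb G R v u ≡ true → u ≢ v
  dirtyNb-≢ {R} {v} p refl
    with trans (sym (∧-conicalʳ (adj G v v) _ (∧-conicalʳ (R v) _ p)))
               (cong not (eqF-≡⁺ (refl {x = v})))
  ... | ()

  dirtyNb-intro : ∀ {R v u} → R u ≡ true → adj G v u ≡ true → u ≢ v → dirtyNb G R v u ≡ true
  dirtyNb-intro Ru vu u≢v = cong₂ _∧_ Ru (cong₂ _∧_ vu (cong not (eqF-≢ u≢v)))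

  edge-towards : ∀ {R v u} → dirtyNb G R v u ≡ true → Σ Edge λ g → Joins g v u
  edge-towards {R} p = edge-between (dirtyNb-adj {R} p) (dirtyNb-≢ {R} p)

  Black : Set
  Black = VSet (length (edgesOf G))

  dirtyEdge : VSet (n G) → Edge → Bool
  dirtyEdge R g = R (proj₁ (ends g)) ∧ R (proj₂ (ends g))

  dirtyEdge-joins : ∀ R {g a x} → Joins g a x → R a ≡ true → R x ≡ true → dirtyEdge R g ≡ true
  dirtyEdge-joins R (inj₁ g≡ax) Ra Rx rewrite g≡ax = cong₂ _∧_ Ra Rx
  dirtyEdge-joins R (inj₂ g≡xa) Ra Rx rewrite g≡xa = cong₂ _∧_ Rx Ra

  dirtyEdge-fired : ∀ R {g a} → Incident a g → R a ≡ false → dirtyEdge R g ≡ false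
  dirtyEdge-fired R (inj₁ refl) Ra rewrite Ra = refl
  dirtyEdge-fired R (inj₂ refl) Ra rewrite Ra = ∧-zeroʳ _

  dirtyEdge-setAt-⊆ : ∀ R v g → dirtyEdge (setAt R v false) g ≡ true → dirtyEdge R g ≡ true
  dirtyEdge-setAt-⊆ R v g d = cong₂ _∧_ (setAt-false-⊆ R v _ (∧-conicalˡ _ _ d))
                                        (setAt-false-⊆ R v _ (∧-conicalʳ _ _ d))

  blackDirty : Black → VSet (n G) → ℕ
  blackDirty S R = count (λ g → S g ∧ dirtyEdge R g)

  Saturated : Black → V → Set
  Saturated S v = ∀ g → Incident v g → S g ≡ true

  cleanedBy : Black → VSet (n G) → V → Black
  cleanedBy S R v g = (S g ∧ dirtyEdge R g) ∧ not (dirtyEdge (setAt R v false) g)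

  blackDirty-fire : ∀ S R v →
    blackDirty S (setAt R v false) + count (cleanedBy S R v) ≤ blackDirty S R
  blackDirty-fire S R v = begin
    blackDirty S R' + count (cleanedBy S R v)
      ≤⟨ +-monoˡ-≤ _ (count-mono-↪ (⊆⇒↪ still-dirty)) ⟩
    count (λ g → (S g ∧ dirtyEdge R g) ∧ dirtyEdge R' g) + count (cleanedBy S R v)
      ≡⟨ count-split (λ g → S g ∧ dirtyEdge R g) (dirtyEdge R') ⟩
    blackDirty S R ∎
    where
    open ≤-Reasoning
    R' : VSet (n G)
    R' = setAt R v false
    still-dirty : ∀ g → S g ∧ dirtyEdge R' g ≡ true → (S g ∧ dirtyEdge R g) ∧ dirtyEdge R' g ≡ true
    still-dirty g h = cong₂ _∧_ (cong₂ _∧_ (∧-conicalˡ (S g) _ h) (dirtyEdge-setAt-⊆ R v g R'g)) R'g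
      where
      R'g : dirtyEdge R' g ≡ true
      R'g = ∧-conicalʳ (S g) _ h

  joins-cleanedBy : ∀ {S R v g u} → R v ≡ true → Saturated S v → Joins g v u → R u ≡ true →
                    cleanedBy S R v g ≡ true
  joins-cleanedBy {R = R} {v} Rv sat g-vu Ru = cong₂ _∧_
    (cong₂ _∧_ (sat _ (joins-incident g-vu)) (dirtyEdge-joins R g-vu Rv Ru))
    (cong not (dirtyEdge-fired (setAt R v false) (joins-incident g-vu) (setAt-≡ R v false)))

  edges-towards-dirty : ∀ {S R v} → R v ≡ true → Saturated S v → dirtyNb G R v ↪ cleanedBy S R v
  edges-towards-dirty {S} {R} {v} Rv sat = record
    { to     = λ u p → proj₁ (edge-towards {R} p)
    ; to-∈   = λ u p → joins-cleanedBy Rv sat (proj₂ (edge-towards {R} p)) (dirtyNb-remaining {R} p)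
    ; to-inj = λ {u} {u'} p p' eq →
        joins-unique (proj₂ (edge-towards {R} p))
                     (subst (λ g → Joins g v u') (sym eq) (proj₂ (edge-towards {R} p')))
    }

  blackDirty-fire-saturated : ∀ {S R v} → R v ≡ true → Saturated S v →
    blackDirty S (setAt R v false) + dirtyDeg G R v ≤ blackDirty S R
  blackDirty-fire-saturated {S} {R} {v} Rv sat =
    ≤-trans (+-monoʳ-≤ _ (count-mono-↪ (edges-towards-dirty Rv sat))) (blackDirty-fire S R v)

  -- Two distinct edges joining v and x are both cleaned while x counts once in dirtyDeg. This
  -- cannot happen in a simple graph, but excluding it would require edgesOf to be duplicate-free.
  blackDirty-fire-parallel : ∀ {S R v x q₁ q₂} → R v ≡ true → Saturated S v → R x ≡ true →
    q₁ ≢ q₂ → Joins q₁ v x → Joins q₂ v x →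
    blackDirty S (setAt R v false) + suc (dirtyDeg G R v) ≤ blackDirty S R
  blackDirty-fire-parallel {S} {R} {v} {x} {q₁} {q₂} Rv sat Rx q₁≢q₂ q₁-vx q₂-vx =
    ≤-trans (+-monoʳ-≤ _ (count-mono-↪-missing ι (joins-cleanedBy Rv sat q-vx Rx) missed))
            (blackDirty-fire S R v)
    where
    ι : dirtyNb G R v ↪ cleanedBy S R v
    ι = edges-towards-dirty Rv sat
    px : dirtyNb G R v x ≡ true
    px = dirtyNb-intro {R} Rx (joins-adj q₁-vx) (joins-≢ q₁-vx ∘ sym)
    other : Σ Edge λ q → Joins q v x × to ι x px ≢ q
    other with to ι x px ≟ᶠ q₁
    ... | yes ≡q₁ = q₂ , q₂-vx , λ ≡q₂ → q₁≢q₂ (trans (sym ≡q₁) ≡q₂)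
    ... | no ≢q₁  = q₁ , q₁-vx , ≢q₁
    q-vx : Joins (proj₁ other) v x
    q-vx = proj₁ (proj₂ other)
    missed : ∀ u p → to ι u p ≢ proj₁ other
    missed u p eq
      with joins-unique (proj₂ (edge-towards {R} p)) (subst (λ g → Joins g v x) (sym eq) q-vx)
    ... | refl = proj₂ (proj₂ other)
                   (trans (cong (to ι x) (Decidable⇒UIP.≡-irrelevant _≟ᵇ_ px p)) eq)

  blackDirty-blacken : ∀ S R F → blackDirty (setAt S F true) R ≤ suc (blackDirty S R)
  blackDirty-blacken S R F =
    ≤-trans (count-mono-↪ (⊆⇒↪ blackened)) (count-setAt-true (λ g → S g ∧ dirtyEdge R g) F)
    where
    blackened : ∀ g → setAt S F true g ∧ dirtyEdge R g ≡ true →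
                setAt (λ g → S g ∧ dirtyEdge R g) F true g ≡ true
    blackened g h with eqF g F
    ... | true  = refl
    ... | false = h

  blackDirty≤count : ∀ S R → blackDirty S R ≤ count S
  blackDirty≤count S R = count-mono-↪ (⊆⇒↪ (λ g → ∧-conicalˡ (S g) _))

  afterFiring : VSet (n G) → V → (V → ℕ) → V → ℕ
  afterFiring R v β u = if dirtyNb G R v u then suc (β u) else β u

  β≤afterFiring : ∀ R v β u → β u ≤ afterFiring R v β u
  β≤afterFiring R v β u with dirtyNb G R v u
  ... | true  = n≤1+n (β u)
  ... | false = ≤-refl

  record Invariant (S : Black) (R : VSet (n G)) (β : V → ℕ) : Set where
    field
      fired-saturated : ∀ {v} → R v ≡ false → Saturated S v
      brushed         : ∀ {u v} → R u ≡ false → R v ≡ true → adj G u v ≡ true → 1 ≤ β v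
  open Invariant

  invariant-fire : ∀ {S R β v} → R v ≡ true → Saturated S v → Invariant S R β →
                   Invariant S (setAt R v false) (afterFiring R v β)
  invariant-fire {S} {R} {β} {v} Rv sat inv = record
    { fired-saturated = fired-saturated′
    ; brushed         = brushed′
    }
    where
    fired-saturated′ : ∀ {u} → setAt R v false u ≡ false → Saturated S u
    fired-saturated′ {u} R'u with u ≟ᶠ v
    ... | yes refl = sat
    ... | no _     = fired-saturated inv R'u
    brushed′ : ∀ {u w} → setAt R v false u ≡ false → setAt R v false w ≡ true → adj G u w ≡ true →
               1 ≤ afterFiring R v β w
    brushed′ {u} {w} R'u R'w uw with u ≟ᶠ v
    ... | yes refl
      rewrite dirtyNb-intro {R} (setAt-false-⊆ R u w R'w) uw (setAt-false-≢ R R'w) = s≤s z≤n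
    ... | no _ = ≤-trans (brushed inv R'u (setAt-false-⊆ R v w R'w) uw)
                           (β≤afterFiring R v β w)

  TopUp : Black → VSet (n G) → (V → ℕ) → Set
  TopUp S R β = Σ (V → ℕ) λ d → sumF d ≤ blackDirty S R × Cleansb G R (λ u → β u + d u)

  fire-topUp : ∀ {S S' R β} v → R v ≡ true →
    blackDirty S' (setAt R v false) + (dirtyDeg G R v ∸ β v) ≤ blackDirty S R →
    TopUp S' (setAt R v false) (afterFiring R v β) → TopUp S R β
  fire-topUp {S} {S'} {R} {β} v Rv budget (d' , d'≤ , cleans) =
    d , d≤ , fire v Rv enough (Cleansb-mono cleans moved≤)
    where
    open ≤-Reasoning
    e : ℕ
    e = dirtyDeg G R v ∸ β v
    d : V → ℕ
    d u = d' u + point v e u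
    d≤ : sumF d ≤ blackDirty S R
    d≤ = begin
      sumF d                                  ≡⟨ sumF-+ d' (point v e) ⟩
      sumF d' + sumF (point v e)              ≡⟨ cong (sumF d' +_) (sumF-point v e) ⟩
      sumF d' + e                             ≤⟨ +-monoˡ-≤ e d'≤ ⟩
      blackDirty S' (setAt R v false) + e     ≤⟨ budget ⟩
      blackDirty S R                          ∎
    enough : dirtyDeg G R v ≤ β v + d v
    enough = begin
      dirtyDeg G R v        ≤⟨ m≤n+m∸n (dirtyDeg G R v) (β v) ⟩
      β v + e               ≤⟨ +-monoʳ-≤ (β v) (m≤n+m e (d' v)) ⟩
      β v + (d' v + e)      ≡⟨ cong (λ x → β v + (d' v + x)) (sym (point-self v e)) ⟩
      β v + d v             ∎
    moved≤ : ∀ u → afterFiring R v β u + d' u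
                   ≤ (if dirtyNb G R v u then suc (β u + d u) else β u + d u)
    moved≤ u with dirtyNb G R v u
    ... | true  = s≤s (+-monoʳ-≤ (β u) (m≤m+n (d' u) _))
    ... | false = +-monoʳ-≤ (β u) (m≤m+n (d' u) _)

  incident? : ∀ v g → Dec (Incident v g)
  incident? v g = (v ≟ᶠ proj₁ (ends g)) ⊎-dec (v ≟ᶠ proj₂ (ends g))

  saturated? : ∀ S v → Dec (Saturated S v)
  saturated? S v = all? (λ g → incident? v g →-dec (S g ≟ᵇ true))

  SaturatedFired : Black → VSet (n G) → Set
  SaturatedFired S R = ∀ v → Saturated S v → R v ≡ false

  fire-saturated : ∀ {S} → (∀ {R β} → Invariant S R β → SaturatedFired S R → TopUp S R β) →
                   ∀ {R β} → Invariant S R β → TopUp S R β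
  fire-saturated {S} stuck {R} = loop (count R) ≤-refl
    where
    loop : ∀ fuel {R β} → count R ≤ fuel → Invariant S R β → TopUp S R β
    loop fuel {R} R≤ inv with any? (λ v → (R v ≟ᵇ true) ×-dec saturated? S v)
    ... | no none = stuck inv satFired
      where
      satFired : SaturatedFired S R
      satFired v sat with R v in Rv
      ... | true  = ⊥-elim (none (v , Rv , sat))
      ... | false = refl
    loop zero {R} R≤ inv | yes (v , Rv , _) with () ← ≤-trans (count-pos R Rv) R≤
    loop (suc fuel) {R} {β} R≤ inv | yes (v , Rv , sat) =
      fire-topUp {S} {S} v Rv budget (loop fuel R'≤ (invariant-fire Rv sat inv))
      where
      R'≤ : count (setAt R v false) ≤ fuel
      R'≤ = s≤s⁻¹ (subst (_≤ suc fuel) (sym (count-remove R Rv)) R≤)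
      budget : blackDirty S (setAt R v false) + (dirtyDeg G R v ∸ β v) ≤ blackDirty S R
      budget = ≤-trans (+-monoʳ-≤ _ (m∸n≤m (dirtyDeg G R v) (β v)))
                       (blackDirty-fire-saturated {S} {R} Rv sat)

  adjL-≢ : ∀ {e f} → adj (L G) e f ≡ true → e ≢ f
  adjL-≢ {e} ef refl
    with trans (sym (∧-conicalˡ (not (eqF e e)) _ ef)) (cong not (eqF-≡⁺ (refl {x = e})))
  ... | ()

  adjL-intro : ∀ {e g y} → Incident y e → Incident y g → g ≢ e → adj (L G) e g ≡ true
  adjL-intro ye yg g≢e = cong₂ _∧_ (cong not (eqF-≢ (g≢e ∘ sym))) (common⇒shareEnd ye yg)

  record Forcing (S : Black) (E F : Edge) : Set where
    field
      E-black      : S E ≡ true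
      F-white      : S F ≡ false
      EF-adj       : adj (L G) E F ≡ true
      others-black : ∀ g → adj (L G) E g ≡ true → g ≢ F → S g ≡ true
  open Forcing

  black-near-forcer : ∀ {S E F y g} → Forcing S E F → Incident y E → Incident y g → g ≢ F →
                      S g ≡ true
  black-near-forcer {E = E} {g = g} forcing yE yg g≢F with g ≟ᶠ E
  ... | yes refl = E-black forcing
  ... | no g≢E   = others-black forcing g (adjL-intro yE yg g≢E) g≢F

  forced-saturated : ∀ {S E F a} → Forcing S E F → Incident a E → Incident a F →
                     Saturated (setAt S F true) a
  forced-saturated {S} {F = F} forcing aE aF g ag with g ≟ᶠ F
  ... | yes refl = refl
  ... | no g≢F   = black-near-forcer forcing aE ag g≢F

  forcer-end-saturated : ∀ {S E F a x w} → Forcing S E F → Joins E a x → Joins F a w → x ≢ w →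
                         Saturated S x
  forcer-end-saturated forcing E-ax F-aw x≢w g xg =
    black-near-forcer forcing (joins-incident (joins-sym E-ax)) xg g≢F
    where
    g≢F : _ ≢ _
    g≢F refl with joins-incident⁻ F-aw xg
    ... | inj₁ x≡a = joins-≢ E-ax (sym x≡a)
    ... | inj₂ x≡w = x≢w x≡w

  invariant-blacken : ∀ {S R β} F → Invariant S R β → Invariant (setAt S F true) R β
  invariant-blacken {S} F inv = record
    { fired-saturated = λ Rv g vg → setAt-true-⊇ S F g (fired-saturated inv Rv g vg)
    ; brushed         = brushed inv
    }

  white-edge-unfired : ∀ {S R β F y} → Invariant S R β → S F ≡ false → Incident y F → R y ≡ true
  white-edge-unfired {R = R} {y = y} inv SF yF with R y in Ry
  ... | true  = refl
  ... | false with trans (sym SF) (fired-saturated inv Ry _ yF)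
  ...   | ()

  force-along : ∀ {S E F a x w} → Forcing S E F → Joins E a x → Joins F a w →
    (∀ {R β} → Invariant (setAt S F true) R β → TopUp (setAt S F true) R β) →
    ∀ {R β} → Invariant S R β → SaturatedFired S R → TopUp S R β
  force-along {S} {E} {F} {a} {x} {w} forcing E-ax F-aw next {R} {β} inv satFired =
    fire-topUp {S} {S'} a Ra budget (next (invariant-fire Ra a-sat (invariant-blacken F inv)))
    where
    S' : Black
    S' = setAt S F true
    a-sat : Saturated S' a
    a-sat = forced-saturated forcing (joins-incident E-ax) (joins-incident F-aw)
    Ra : R a ≡ true
    Ra = white-edge-unfired inv (F-white forcing) (joins-incident F-aw)
    Rw : R w ≡ true
    Rw = white-edge-unfired inv (F-white forcing) (joins-incident (joins-sym F-aw))
    budget : blackDirty S' (setAt R a false) + (dirtyDeg G R a ∸ β a) ≤ blackDirty S R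
    budget with x ≟ᶠ w
    ... | yes refl = m+1+n≤1+p⇒m+[n∸o]≤p _ _ (β a)
          (≤-trans (blackDirty-fire-parallel {S'} {R} Ra a-sat Rw
                     (adjL-≢ (EF-adj forcing)) E-ax F-aw)
                   (blackDirty-blacken S R F))
    ... | no x≢w = m+n≤1+p⇒m+[n∸o]≤p _ _ (β a)
          (≤-trans (blackDirty-fire-saturated {S'} {R} Ra a-sat) (blackDirty-blacken S R F))
          (count-pos (dirtyNb G R a) (dirtyNb-intro {R} Rw (joins-adj F-aw) (joins-≢ F-aw ∘ sym)))
          (brushed inv {v = a} (satFired x (forcer-end-saturated forcing E-ax F-aw x≢w)) Ra
                   (joins-adj (joins-sym E-ax)))

  force-step : ∀ {S E F} → Forcing S E F →
    (∀ {R β} → Invariant (setAt S F true) R β → TopUp (setAt S F true) R β) →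
    ∀ {R β} → Invariant S R β → SaturatedFired S R → TopUp S R β
  force-step {E = E} {F} forcing
    with shareEnd⇒common E F (∧-conicalʳ (not (eqF E F)) _ (EF-adj forcing))
  ... | _ , aE , aF = force-along forcing (proj₂ (incident-joins aE)) (proj₂ (incident-joins aF))

  ZF⇒TopUp : ∀ {S} → ZF (L G) S → ∀ {R β} → Invariant S R β → TopUp S R β
  ZF⇒TopUp {S} (allBlack black) = fire-saturated λ {R} _ satFired →
    (λ _ → 0) , subst (_≤ blackDirty S R) (sym (sumF-zero (n G))) z≤n ,
    done (λ v → satFired v (λ g _ → black g))
  ZF⇒TopUp (force E F E-black F-white EF-adj others-black rest) =
    fire-saturated (force-step (record { E-black = E-black ; F-white = F-white
                                       ; EF-adj = EF-adj ; others-black = others-black })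
                               (ZF⇒TopUp rest))

  initial-invariant : ∀ S → Invariant S allV (λ _ → 0)
  initial-invariant S = record { fired-saturated = λ () ; brushed = λ () }

-- The bound b(G) ≤ Z(L(G)) holds without the isolated-vertex term k: an isolated vertex has
-- no dirty edges, so it fires with no brush.
corollary3 : (G : Graph) → IsSimple G → (k : ℕ) → numIsolated G ≡ k →
    (bigB smallb z : ℕ) → IsBigB G bigB → IsSmallb G smallb → IsZ (L G) z →
    bigB ≤ smallb × smallb ≤ z + k
corollary3 G (adj-sym , _) k _ bigB smallb z
           (_ , B-minimal) ((c , c-cleans , c-total) , b-minimal) ((S , S-forces , S-size) , _) =
  B≤b , b≤Z+k
  where
  open BrushingAlongForcing G adj-sym
  open ≤-Reasoning

  B≤b : bigB ≤ smallb
  B≤b = subst (bigB ≤_) c-total (B-minimal c (Cleansb⇒CleansB c-cleans (λ _ → refl)))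

  topUp : TopUp S allV (λ _ → 0)
  topUp = ZF⇒TopUp S-forces (initial-invariant S)

  b≤Z+k : smallb ≤ z + k
  b≤Z+k = begin
    smallb                ≤⟨ b-minimal (proj₁ topUp) (proj₂ (proj₂ topUp)) ⟩
    sumF (proj₁ topUp)    ≤⟨ proj₁ (proj₂ topUp) ⟩
    blackDirty S allV     ≤⟨ blackDirty≤count S allV ⟩
    count S               ≡⟨ S-size ⟩
    z                     ≤⟨ m≤m+n z k ⟩
    z + k                 ∎
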